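{- For all integers $n\ge0$, \[T_{n}^2=\delta_{n,2}-\delta_{n,3}-\delta_{n,4}-\delta_{n,5}+2T_{n-1}^2+3T_{n-2}^2+6T_{n-3}^2-T_{n-4}^2-T_{n-6}^2.\]
   Context: Tribonacci numbers: $T_n=T_{n-1}+T_{n-2}+T_{n-3}+\delta_{n,2}$ for all integers $n$, with $T_n=0$ for $n<2$; $\delta_{i,j}$ is $1$ if $i=j$ and $0$ otherwise. -}

module Defs where

open import Data.Nat using (ℕ; zero; suc)
open import Data.Integer using (ℤ; +_; -[1+_]; _+_; _≟_)
open import Relation.Nullary using (yes; no)

tribℕ : ℕ → ℤ
tribℕ zero = + 0
tribℕ (suc zero) = + 0
tribℕ (suc (suc zero)) = + 1
tribℕ (suc (suc (suc k))) = tribℕ (suc (suc k)) + tribℕ (suc k) + tribℕ k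

T : ℤ → ℤ
T (+ k) = tribℕ k
T -[1+ k ] = + 0

δ : ℤ → ℤ → ℤ
δ i j with i ≟ j
... | yes _ = + 1
... | no _ = + 0

{-# OPTIONS --safe #-}
module Submission where

-- A sequence with t(k+3) = t(k+2) + t(k+1) + t(k) is determined by three
-- consecutive values, so the squared recurrence is a polynomial identity in them.
-- For n ≥ 7 every Kronecker term vanishes; the cases n ≤ 6, where the
-- δ corrections and the convention T = 0 below 2 matter, are closed by computation.

open import Defs
open import Data.Nat as ℕ using (ℕ; suc)
open import Data.Integer using (ℤ; +_; _+_; _-_; _*_)
open import Relation.Binary.PropositionalEquality using (_≡_; refl; trans)
open import Data.Integer.Tactic.RingSolver using (solve-∀)

tribonacci-like-square-recurrence : ∀ (t₁ t₂ t₃ : ℤ) →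
  let t₄ = t₃ + t₂ + t₁
      t₅ = t₄ + t₃ + t₂
      t₆ = t₅ + t₄ + t₃
      t₇ = t₆ + t₅ + t₄
  in t₇ * t₇ ≡ + 2 * (t₆ * t₆) + + 3 * (t₅ * t₅) + + 6 * (t₄ * t₄) - t₃ * t₃ - t₁ * t₁
tribonacci-like-square-recurrence = solve-∀

tribℕ² : ℕ → ℤ
tribℕ² n = tribℕ n * tribℕ n

tribℕ²-recurrence : ∀ k →
  tribℕ² (7 ℕ.+ k) ≡
    + 2 * tribℕ² (6 ℕ.+ k) + + 3 * tribℕ² (5 ℕ.+ k) + + 6 * tribℕ² (4 ℕ.+ k)
    - tribℕ² (3 ℕ.+ k) - tribℕ² (1 ℕ.+ k)
tribℕ²-recurrence k =
  tribonacci-like-square-recurrence (tribℕ (1 ℕ.+ k)) (tribℕ (2 ℕ.+ k)) (tribℕ (3 ℕ.+ k))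

+-identityˡ-prefix : ∀ (a b c d e : ℤ) → a + b + c - d - e ≡ + 0 + a + b + c - d - e
+-identityˡ-prefix = solve-∀

mainTheorem6 : (n : ℕ) →
    T (+ n) * T (+ n) ≡
      δ (+ n) (+ 2) - δ (+ n) (+ 3) - δ (+ n) (+ 4) - δ (+ n) (+ 5)
      + + 2 * (T (+ n - + 1) * T (+ n - + 1))
      + + 3 * (T (+ n - + 2) * T (+ n - + 2))
      + + 6 * (T (+ n - + 3) * T (+ n - + 3))
      - T (+ n - + 4) * T (+ n - + 4)
      - T (+ n - + 6) * T (+ n - + 6)
mainTheorem6 0 = refl
mainTheorem6 1 = refl
mainTheorem6 2 = refl
mainTheorem6 3 = refl
mainTheorem6 4 = refl
mainTheorem6 5 = refl
mainTheorem6 6 = refl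
mainTheorem6 (suc (suc (suc (suc (suc (suc (suc k))))))) =
  trans (tribℕ²-recurrence k)
        (+-identityˡ-prefix (+ 2 * tribℕ² (6 ℕ.+ k)) (+ 3 * tribℕ² (5 ℕ.+ k))
                            (+ 6 * tribℕ² (4 ℕ.+ k)) (tribℕ² (3 ℕ.+ k)) (tribℕ² (1 ℕ.+ k)))
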